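{- For any bipartite graph $G$, $$\gamma_{\rm sp}(G)\ge \alpha(G).$$
   Context: All graphs are finite, simple and undirected. For a vertex $v$ of a graph $G$, $N(v)$ denotes the set of vertices adjacent to $v$. For $D\subseteq V(G)$ write $\overline{D}=V(G)\setminus D$. A set $D\subseteq V(G)$ is a super dominating set of $G$ if for every $u\in\overline{D}$ there exists $v\in D$ such that $N(v)\cap\overline{D}=\{u\}$. The super domination number $\gamma_{\rm sp}(G)$ is the minimum cardinality of a super dominating set of $G$. The independence number $\alpha(G)$ is the maximum cardinality of a set of pairwise non-adjacent vertices of $G$. -}

module Defs where

open import Data.Nat using (ℕ; _≤_)
open import Data.Fin using (Fin)
open import Data.Fin.Subset using (Subset; _∈_; _∉_; ∣_∣)
open import Data.Bool using (Bool)
open import Data.Product using (Σ; _×_; ∃)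
open import Relation.Binary.PropositionalEquality using (_≡_; _≢_)
open import Relation.Nullary using (¬_)
open import Level using (0ℓ) renaming (suc to lsuc)

record Graph (n : ℕ) : Set₁ where
  field
    Adj     : Fin n → Fin n → Set
    sym     : ∀ {u v} → Adj u v → Adj v u
    irrefl  : ∀ {u} → ¬ Adj u u
open Graph public

Bipartite : ∀ {n} → Graph n → Set
Bipartite {n} G = Σ (Fin n → Bool) λ c → ∀ {u v} → Adj G u v → c u ≢ c v

Independent : ∀ {n} → Graph n → Subset n → Set
Independent G I = ∀ {u v} → u ∈ I → v ∈ I → ¬ Adj G u v

SuperDominating : ∀ {n} → Graph n → Subset n → Set
SuperDominating G D =
  ∀ u → u ∉ D →
    ∃ λ v → v ∈ D × Adj G v u × (∀ w → w ∉ D → Adj G v w → w ≡ u)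

-- Each vertex u of an independent set I is sent into a super dominating set
-- D: to itself if u ∈ D, and otherwise to a vertex of D whose only neighbour
-- outside D is u. Two vertices outside D cannot share such a vertex, and a
-- vertex of I ∩ D cannot serve a vertex of I ∖ D, since they would be adjacent.
-- The map is therefore injective, so ∣ I ∣ ≤ ∣ D ∣ in every graph.
module Submission where

open import Defs hiding (sym)
open import Data.Nat using (ℕ; _≤_)
open import Data.Fin using (Fin; zero; suc)
open import Data.Fin.Properties using (injective⇒≤; suc-injective)
open import Data.Fin.Subset using (Subset; ∣_∣; _∈_; _∉_; inside; outside)
open import Data.Fin.Subset.Properties using (_∈?_)
open import Data.Vec using (_∷_; here; there)
open import Data.Product using (_,_; proj₁; proj₂)
open import Data.Empty using (⊥-elim)
open import Relation.Nullary using (Dec; yes; no)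
open import Relation.Binary.PropositionalEquality using (_≡_; refl; sym; cong; subst)

private
  variable
    n : ℕ
    p q : Subset n
    x y : Fin n

member : (p : Subset n) → Fin ∣ p ∣ → Fin n
member (inside  ∷ p) zero    = zero
member (inside  ∷ p) (suc k) = suc (member p k)
member (outside ∷ p) k       = suc (member p k)

member-∈ : (p : Subset n) (k : Fin ∣ p ∣) → member p k ∈ p
member-∈ (inside  ∷ p) zero    = here
member-∈ (inside  ∷ p) (suc k) = there (member-∈ p k)
member-∈ (outside ∷ p) k       = there (member-∈ p k)

member-injective : (p : Subset n) {i j : Fin ∣ p ∣} → member p i ≡ member p j → i ≡ j
member-injective (inside  ∷ p) {zero}  {zero}  _ = refl
member-injective (inside  ∷ p) {suc i} {suc j} e = cong suc (member-injective p (suc-injective e))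
member-injective (outside ∷ p)                 e = member-injective p (suc-injective e)

position : x ∈ p → Fin ∣ p ∣
position {p = inside  ∷ p} here      = zero
position {p = inside  ∷ p} (there h) = suc (position h)
position {p = outside ∷ p} (there h) = position h

position-injective : (hx : x ∈ p) (hy : y ∈ p) → position hx ≡ position hy → x ≡ y
position-injective {p = inside  ∷ p} here       here       _ = refl
position-injective {p = inside  ∷ p} (there hx) (there hy) e =
  cong suc (position-injective hx hy (suc-injective e))
position-injective {p = outside ∷ p} (there hx) (there hy) e =
  cong suc (position-injective hx hy e)

∣p∣≤∣q∣-by-injection : (f : ∀ {x} → x ∈ p → Fin n) → (∀ {x} (h : x ∈ p) → f h ∈ q) →
  (∀ {x y} (hx : x ∈ p) (hy : y ∈ p) → f hx ≡ f hy → x ≡ y) → ∣ p ∣ ≤ ∣ q ∣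
∣p∣≤∣q∣-by-injection {p = p} {q = q} f f-∈ f-injective = injective⇒≤ g-injective
  where
  g : Fin ∣ p ∣ → Fin ∣ q ∣
  g k = position {p = q} (f-∈ (member-∈ p k))

  g-injective : ∀ {i j} → g i ≡ g j → i ≡ j
  g-injective {i} {j} e = member-injective p
    (f-injective (member-∈ p i) (member-∈ p j) (position-injective (f-∈ _) (f-∈ _) e))

module _ (G : Graph n) {D : Subset n} (superDom : SuperDominating G D) where

  privateDominator : x ∉ D → Fin n
  privateDominator x∉D = proj₁ (superDom _ x∉D)

  privateDominator-∈ : (x∉D : x ∉ D) → privateDominator x∉D ∈ D
  privateDominator-∈ x∉D = proj₁ (proj₂ (superDom _ x∉D))

  privateDominator-adj : (x∉D : x ∉ D) → Adj G (privateDominator x∉D) x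
  privateDominator-adj x∉D = proj₁ (proj₂ (proj₂ (superDom _ x∉D)))

  privateDominator-injective : (x∉D : x ∉ D) (y∉D : y ∉ D) →
    privateDominator x∉D ≡ privateDominator y∉D → x ≡ y
  privateDominator-injective {x} x∉D y∉D e =
    sym (proj₂ (proj₂ (proj₂ (superDom x x∉D))) _ y∉D
      (subst (λ v → Adj G v _) (sym e) (privateDominator-adj y∉D)))

  representative : (x : Fin n) → Dec (x ∈ D) → Fin n
  representative x (yes _)   = x
  representative x (no x∉D) = privateDominator x∉D

  representative-∈ : (x : Fin n) (x∈?D : Dec (x ∈ D)) → representative x x∈?D ∈ D
  representative-∈ x (yes x∈D) = x∈D
  representative-∈ x (no x∉D)  = privateDominator-∈ x∉D

  representative-injective : {I : Subset n} → Independent G I → x ∈ I → y ∈ I →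
    (x∈?D : Dec (x ∈ D)) (y∈?D : Dec (y ∈ D)) →
    representative x x∈?D ≡ representative y y∈?D → x ≡ y
  representative-injective indep x∈I y∈I (yes _)   (yes _)   e = e
  representative-injective indep x∈I y∈I (yes _)   (no y∉D)  e =
    ⊥-elim (indep x∈I y∈I (subst (λ v → Adj G v _) (sym e) (privateDominator-adj y∉D)))
  representative-injective indep x∈I y∈I (no x∉D)  (yes _)   e =
    ⊥-elim (indep y∈I x∈I (subst (λ v → Adj G v _) e (privateDominator-adj x∉D)))
  representative-injective indep x∈I y∈I (no x∉D)  (no y∉D)  e =
    privateDominator-injective x∉D y∉D e

  independent≤superDominating : {I : Subset n} → Independent G I → ∣ I ∣ ≤ ∣ D ∣
  independent≤superDominating indep =
    ∣p∣≤∣q∣-by-injection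
      (λ {x} _ → representative x (x ∈? D))
      (λ {x} _ → representative-∈ x (x ∈? D))
      (λ {x} {y} x∈I y∈I → representative-injective indep x∈I y∈I (x ∈? D) (y ∈? D))

theorem7 : ∀ (n : ℕ) (G : Graph n) → Bipartite G →
    ∀ (D I : Subset n) → SuperDominating G D → Independent G I → ∣ I ∣ ≤ ∣ D ∣
theorem7 n G _ D I superDom indep = independent≤superDominating G superDom indep
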